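{- Let $S$ be an array-based transition system with a single array state variable $x$ satisfying the shape assumptions below, and $\tilde S$ its parameter abstraction. Let $\mathcal{M}$ be a model of $A^E_I$, let $\tilde s$ be a state of $\tilde S$, and let $\mu$ be an interpretation of $P$ with $\mu(P)=\tilde s(P)$. Let $\phi(P,x)$ be a quantifier-free formula whose only free index variables are prophecy variables. Then for every state $s$ of $S$ with $(s,\tilde s)\in\mathcal{S}$, $$\tilde s\models\phi(P,x)\iff s,\mu\models\phi(P,x).$$
   Context: Fix an index theory $\mathcal{T}_I$ all of whose models have finite universes and a quantifier-free element theory $\mathcal{T}_E$; $A^E_I$ is their combination with an array theory whose only symbol $\cdot[\cdot]$ is function application (arrays denote total functions from the index universe to the element universe). $S=(x,\iota(x),\tau(x,x'))$ is an array-based transition system: $\iota,\tau$ are formulas with quantified variables only of index sort; a state is a valuation of $x$ in a model $\mathcal{M}$ of $A^E_I$. Shape assumptions: $\iota$ is universal, and $\tau$ is a finite disjunction of formulas $\exists I\forall J.\psi(I,J,x,x')$ with $\psi$ quantifier-free. Parameter abstraction: $P=(p_1,\dots,p_n)$ are fresh frozen index-sort variables (prophecy variables), $E=(e_1,\dots,e_m)$ fresh non-frozen index-sort variables (environmental variables), $m$ the largest length of an existential block among the disjuncts of $\tau$; values of $P\cup E$ are assumed pairwise different. $\tilde\iota(P,\tilde x)$ expands every universal quantifier of $\iota$ as a conjunction over $P$. For each disjunct and each substitution $\sigma$ of its existential variables by elements of $P\cup E$, the rule $\tilde\tau_\sigma$ applies $\sigma$ to $\psi$ and expands $\forall J$ as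 a conjunction over instantiations in $P\cup E$. The stuttering transition is $\tilde\tau_S:=\bigwedge_{p\in P}(\tilde x'[p]=\tilde x[p]\wedge p'=p)$. $\tilde S=(\{\tilde x,P,E\},\tilde\iota,\tilde\tau)$ with $\tilde\tau$ the disjunction of $\tilde\tau_S$ and all $\tilde\tau_\sigma$; $\tilde x$ is a renaming of $x$, and a state $\tilde s$ of $\tilde S$ assigns $\tilde x$ and $P\cup E$ in a model of $A^E_I$ (formulas over $x$ are evaluated in $\tilde s$ by reading $x$ as $\tilde x$). The relation $\mathcal{S}$: for states $s$ of $S$ and $\tilde s$ of $\tilde S$ in the same model $\mathcal{M}$, $(s,\tilde s)\in\mathcal{S}$ iff $\mathcal{M},s,\tilde s\models\bigwedge_{i=1}^n\tilde x[p_i]=x[p_i]$. -}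

module Defs where

open import Data.Nat using (ℕ)
open import Data.Fin using (Fin)
open import Data.Vec using (Vec; []; _∷_)
open import Data.Product using (Σ; _×_)
open import Data.Sum using (_⊎_)
open import Data.Empty using (⊥)
open import Data.Unit using (⊤)
open import Relation.Nullary using (¬_)
open import Relation.Binary.PropositionalEquality using (_≡_; _≢_)
open import Function.Bundles using (_↔_)

-- Index sort: relational signature (index relation symbols, plus =).
-- Array sort: the only symbol is the read  _[_] : Array × Index → Elem.

record Signature : Set₁ where
  field
    IRel   : Set
    iarity : IRel → ℕ
    EFun   : Set
    earity : EFun → ℕ
    ERel   : Set
    erarity : ERel → ℕ

Finite : Set → Set
Finite A = Σ ℕ (λ k → A ↔ Fin k)

-- Arrays are interpreted as
-- *all* total functions from the index universe to the element universe
-- (this is what models of the array theory look like), so arrays are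
-- not a separate field: an array value is a function  Idx → Elem.
record Structure (Sg : Signature) : Set₁ where
  open Signature Sg
  field
    Idx   : Set
    Elem  : Set
    irelI : (r : IRel) → Vec Idx (iarity r) → Set
    efunI : (f : EFun) → Vec Elem (earity f) → Elem
    erelI : (r : ERel) → Vec Elem (erarity r) → Set

Array : {Sg : Signature} → Structure Sg → Set
Array M = Structure.Idx M → Structure.Elem M

-- Quantifier-free formulas φ(P, x) whose free index variables are among
-- the n prophecy variables P = (p_1,…,p_n) (Fin n) and whose only array
-- variable is x.  Index terms are therefore just prophecy variables.

module _ (Sg : Signature) (n : ℕ) where
  open Signature Sg

  data ETerm : Set where
    read : Fin n → ETerm
    app  : (f : EFun) → Vec ETerm (earity f) → ETerm

  data QFFormula : Set where
    tt ff : QFFormula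
    ieq   : Fin n → Fin n → QFFormula
    irel  : (r : IRel) → Vec (Fin n) (iarity r) → QFFormula
    eeq   : ETerm → ETerm → QFFormula
    erel  : (r : ERel) → Vec ETerm (erarity r) → QFFormula
    neg   : QFFormula → QFFormula
    conj disj : QFFormula → QFFormula → QFFormula

module _ {Sg : Signature} {n : ℕ} (M : Structure Sg) where
  open Structure M

  mutual
    evalT : (Fin n → Idx) → Array M → ETerm Sg n → Elem
    evalT ν a (read i)   = a (ν i)
    evalT ν a (app f ts) = efunI f (evalTs ν a ts)

    evalTs : ∀ {k} → (Fin n → Idx) → Array M → Vec (ETerm Sg n) k → Vec Elem k
    evalTs ν a []       = []
    evalTs ν a (t ∷ ts) = evalT ν a t ∷ evalTs ν a ts

  mapIdx : ∀ {k} → (Fin n → Idx) → Vec (Fin n) k → Vec Idx k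
  mapIdx ν []       = []
  mapIdx ν (i ∷ is) = ν i ∷ mapIdx ν is

  Sat : (Fin n → Idx) → Array M → QFFormula Sg n → Set
  Sat ν a tt          = ⊤
  Sat ν a ff          = ⊥
  Sat ν a (ieq i j)   = ν i ≡ ν j
  Sat ν a (irel r is) = irelI r (mapIdx ν is)
  Sat ν a (eeq t u)   = evalT ν a t ≡ evalT ν a u
  Sat ν a (erel r ts) = erelI r (evalTs ν a ts)
  Sat ν a (neg φ)     = ¬ Sat ν a φ
  Sat ν a (conj φ ψ)  = Sat ν a φ × Sat ν a ψ
  Sat ν a (disj φ ψ)  = Sat ν a φ ⊎ Sat ν a ψ

StateS : {Sg : Signature} → Structure Sg → Set
StateS M = Array M

-- A state of the parameter abstraction S̃: values of x̃, of the n
-- prophecy variables P and of the m environmental variables E.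
record StateAbs {Sg : Signature} (M : Structure Sg) (n m : ℕ) : Set where
  field
    xt : Array M
    P  : Fin n → Structure.Idx M
    E  : Fin m → Structure.Idx M

PairwiseDistinct : {Sg : Signature} {M : Structure Sg} {n m : ℕ} →
                   StateAbs M n m → Set
PairwiseDistinct st =
  (∀ i j → P i ≡ P j → i ≡ j) ×
  (∀ i j → E i ≡ E j → i ≡ j) ×
  (∀ i j → P i ≢ E j)
  where open StateAbs st

SimRel : {Sg : Signature} {M : Structure Sg} {n m : ℕ} →
         StateS M → StateAbs M n m → Set
SimRel s st = ∀ i → xt (P i) ≡ s (P i)
  where open StateAbs st

-- A quantifier-free formula over P and x only inspects the values of the
-- prophecy variables and the contents of x at those values. The simulation
-- relation makes x̃ and x agree there, and μ agrees with s̃(P), so both sides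
-- evaluate every atom to the same thing.
module Submission where

open import Defs
open import Data.Nat using (ℕ)
open import Data.Fin using (Fin)
open import Data.Vec using (Vec; []; _∷_)
open import Data.Product.Function.NonDependent.Propositional using (_×-⇔_)
open import Data.Sum.Function.Propositional using (_⊎-⇔_)
open import Function.Base using (_∘_)
open import Function.Bundles using (_⇔_)
open import Function.Construct.Identity using (⇔-id)
open import Function.Related.TypeIsomorphisms using (¬-cong-⇔)
open import Relation.Binary.PropositionalEquality
  using (_≡_; _≗_; refl; sym; trans; cong; cong₂)

≡⇒⇔ : ∀ {a} {A B : Set a} → A ≡ B → A ⇔ B
≡⇒⇔ {A = A} refl = ⇔-id A

module _ {Sg : Signature} {n : ℕ} (M : Structure Sg) where
  open Structure M

  module _ {ν μ : Fin n → Idx} {a b : Array M} (a∘ν≗b∘μ : a ∘ ν ≗ b ∘ μ) where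

    mutual
      evalT-cong : (t : ETerm Sg n) → evalT M ν a t ≡ evalT M μ b t
      evalT-cong (read i)   = a∘ν≗b∘μ i
      evalT-cong (app f ts) = cong (efunI f) (evalTs-cong ts)

      evalTs-cong : ∀ {k} (ts : Vec (ETerm Sg n) k) →
                    evalTs M ν a ts ≡ evalTs M μ b ts
      evalTs-cong []       = refl
      evalTs-cong (t ∷ ts) = cong₂ _∷_ (evalT-cong t) (evalTs-cong ts)

  mapIdx-cong : ∀ {ν μ : Fin n → Idx} → ν ≗ μ →
                ∀ {k} (is : Vec (Fin n) k) → mapIdx M ν is ≡ mapIdx M μ is
  mapIdx-cong ν≗μ []       = refl
  mapIdx-cong ν≗μ (i ∷ is) = cong₂ _∷_ (ν≗μ i) (mapIdx-cong ν≗μ is)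

  Sat-cong : ∀ {ν μ : Fin n → Idx} {a b : Array M} →
             ν ≗ μ → a ∘ ν ≗ b ∘ μ →
             (φ : QFFormula Sg n) → Sat M ν a φ ⇔ Sat M μ b φ
  Sat-cong {ν} {μ} {a} {b} ν≗μ a∘ν≗b∘μ = go
    where
    go : (φ : QFFormula Sg n) → Sat M ν a φ ⇔ Sat M μ b φ
    go tt          = ⇔-id _
    go ff          = ⇔-id _
    go (ieq i j)   = ≡⇒⇔ (cong₂ _≡_ (ν≗μ i) (ν≗μ j))
    go (irel r is) = ≡⇒⇔ (cong (irelI r) (mapIdx-cong ν≗μ is))
    go (eeq t u)   = ≡⇒⇔ (cong₂ _≡_ (evalT-cong a∘ν≗b∘μ t) (evalT-cong a∘ν≗b∘μ u))
    go (erel r ts) = ≡⇒⇔ (cong (erelI r) (evalTs-cong a∘ν≗b∘μ ts))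
    go (neg φ)     = ¬-cong-⇔ (go φ)
    go (conj φ ψ)  = go φ ×-⇔ go ψ
    go (disj φ ψ)  = go φ ⊎-⇔ go ψ

mainTheorem6 : (Sg : Signature) (TI TE : Structure Sg → Set) →
    (∀ N → TI N → Finite (Structure.Idx N)) →
    (n m : ℕ) (M : Structure Sg) → TI M → TE M →
    (st : StateAbs M n m) → PairwiseDistinct st →
    (μ : Fin n → Structure.Idx M) → (∀ i → μ i ≡ StateAbs.P st i) →
    (φ : QFFormula Sg n) →
    (s : StateS M) → SimRel s st →
    Sat M (StateAbs.P st) (StateAbs.xt st) φ ⇔ Sat M μ s φ
-- Neither finiteness of the index models nor distinctness of P ∪ E is needed.
mainTheorem6 _ _ _ _ _ _ M _ _ st _ μ μ≗P φ s sim =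
  Sat-cong M P≗μ x̃∘P≗s∘μ φ
  where
  open StateAbs st
  P≗μ : P ≗ μ
  P≗μ i = sym (μ≗P i)
  x̃∘P≗s∘μ : xt ∘ P ≗ s ∘ μ
  x̃∘P≗s∘μ i = trans (sim i) (cong s (P≗μ i))
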